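{- Let $G=(V,E)$ be an undirected unweighted graph on $n$ vertices accessed via cut queries, and let $(V_1,\dots,V_z)$ be a partition of $V$. Then all edges of $G\langle V_1,\dots,V_z\rangle$ can be learned using $\widetilde{O}\big(z+|G\langle V_1,\dots,V_z\rangle|\big)$ cut queries.
   Context: A cut query specifies a partition $(S,V\setminus S)$ and returns the number of edges of $G$ crossing it. $G\langle V_1,\dots,V_z\rangle$ denotes $G$ with all edges inside each $G[V_i]$ removed (equivalently, the weighted graph obtained by contracting each $V_i$ into a super-vertex), and $|G\langle V_1,\dots,V_z\rangle|$ is its number of edges, i.e. the number of edges of $G$ whose endpoints lie in different parts. $\widetilde{O}$ hides polylogarithmic factors in $n$. -}

module Defs where

open import Data.Nat using (ℕ; zero; suc; _+_; _*_; _^_; _<_; _<ᵇ_)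
open import Data.Nat.Logarithm using (⌊log₂_⌋)
open import Data.Bool using (Bool; true; false; _∧_; not; if_then_else_)
open import Data.Fin using (Fin; toℕ; _≟_)
open import Data.List using (List; map; allFin)
open import Data.Nat.ListAction using (sum)
open import Data.Product using (_×_; _,_; proj₁; proj₂)
open import Relation.Nullary.Decidable using (⌊_⌋)
open import Relation.Binary.PropositionalEquality using (_≡_)

record Graph (n : ℕ) : Set where
  field
    adj   : Fin n → Fin n → Bool
    sym   : ∀ u v → adj u v ≡ adj v u
    irrefl : ∀ u → adj u u ≡ false
open Graph public

Σᶠ : {n : ℕ} → (Fin n → ℕ) → ℕ
Σᶠ {n} f = sum (map f (allFin n))

ind : Bool → ℕ
ind true = 1
ind false = 0

VertexSet : ℕ → Set
VertexSet n = Fin n → Bool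

-- Cut query: number of edges of G with exactly one endpoint in S
-- (each edge {u,v} counted once, via the ordered pair (u ∈ S, v ∉ S)).
cutQuery : {n : ℕ} → Graph n → VertexSet n → ℕ
cutQuery G S = Σᶠ λ u → Σᶠ λ v → ind (adj G u v ∧ S u ∧ not (S v))

-- A partition (V_1,…,V_z) of V is given by the map sending each vertex to
-- the index of its part. Adjacency of G⟨V_1,…,V_z⟩: edges of G whose
-- endpoints lie in different parts.
crossAdj : {n z : ℕ} → Graph n → (Fin n → Fin z) → Fin n → Fin n → Bool
crossAdj G part u v = adj G u v ∧ not ⌊ part u ≟ part v ⌋

crossCount : {n z : ℕ} → Graph n → (Fin n → Fin z) → ℕ
crossCount G part =
  Σᶠ λ u → Σᶠ λ v → ind ((toℕ u <ᵇ toℕ v) ∧ crossAdj G part u v)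

-- Deterministic adaptive cut-query algorithm on vertex set Fin n:
-- a decision tree that either asks a cut query S and continues depending
-- on the answer, or stops and outputs an edge set (adjacency relation).
data QueryTree (n : ℕ) : Set where
  done : (Fin n → Fin n → Bool) → QueryTree n
  ask  : VertexSet n → (ℕ → QueryTree n) → QueryTree n

output : {n : ℕ} → Graph n → QueryTree n → Fin n → Fin n → Bool
output G (done E) = E
output G (ask S k) = output G (k (cutQuery G S))

numQueries : {n : ℕ} → Graph n → QueryTree n → ℕ
numQueries G (done E) = 0
numQueries G (ask S k) = suc (numQueries G (k (cutQuery G S)))

-- The polylogarithmic factor base: 1 + ⌊log₂ n⌋ (≥ 1 for all n).
logFactor : ℕ → ℕ
logFactor n = suc ⌊log₂ n ⌋

-- For disjoint vertex sets A and B, cut(A) + cut(B) = cut(A ∪ B) + 2·e(A, B), so three cut queries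
-- tell whether some edge joins A and B. Halving A and B along the bits of the vertex indices and
-- discarding every pair of halves that no edge joins learns all edges between A and B with
-- O(1 + e(A, B) · log n) queries: each edge is found by a binary search of depth O(log n).
-- Two vertices lie in different parts iff their part indices (at most n of them) differ in one of
-- the 1 + ⌊log₂ n⌋ low bits, so running this search once per bit j, between the vertices whose part
-- index has bit j clear and those where it is set, learns G⟨V₁,…,V_z⟩ with
-- O((1 + |G⟨V₁,…,V_z⟩|) · log² n) queries.

module Submission where

open import Defs hiding (sym)
open import Data.Bool using (Bool; true; false; _∧_; _∨_; not; T)
import Data.Bool.Properties as 𝔹
open import Data.Bool.Solver using (module ∨-∧-Solver)
open import Data.Empty using (⊥-elim)
open import Data.Fin using (Fin; zero; suc; toℕ)
open import Data.Fin.Properties as F using (toℕ-injective; toℕ<n; ¬Fin0; injective⇒≤)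
open import Data.List.Properties using (map-tabulate)
open import Data.Nat
  using (ℕ; zero; suc; _+_; _*_; _^_; _≤_; _<_; _<ᵇ_; z≤n; s≤s; s≤s⁻¹; z<s; s<s; NonZero; ⌊_/2⌋)
open import Data.Nat.ListAction using (sum)
open import Data.Nat.Logarithm using (⌊log₂_⌋; ⌊log₂⌋-mono-≤; ⌊log₂[2^n]⌋≡n)
open import Data.Nat.Properties as ℕ
  using ( ≤-refl; ≤-trans; ≤-reflexive; <-≤-trans; <⇒≤; ≰⇒>; 1+n≰n; <-cmp; <⇒<ᵇ; n≢0⇒n>0
        ; +-mono-≤; +-monoˡ-≤; +-monoʳ-≤; *-monoˡ-≤; *-monoʳ-≤; m≤m+n; m≤n+m; m≤m*n; m≤n*m
        ; +-suc; *-suc; +-identityʳ; +-cancelˡ-≡; *-cancelˡ-≡; m+n≡0⇒m≡0; m+n≡0⇒n≡0; suc-injective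
        ; module ≤-Reasoning)
open import Data.Nat.Solver using (module +-*-Solver)
open import Data.Product using (Σ; ∃; ∃₂; ∃-syntax; _×_; _,_; proj₁; proj₂)
open import Data.Unit using (tt)
open import Function using (id; _∘_; flip; Equivalence)
open import Function.Definitions using (Surjective)
open import Relation.Binary.Definitions using (tri<; tri≈; tri>)
open import Relation.Binary.PropositionalEquality
open import Relation.Nullary using (Dec; yes; no)
open import Relation.Nullary.Decidable using (⌊_⌋)

variable
  n z : ℕ
  A B U A₀ A₁ B₀ B₁ : VertexSet n
  R R′ : Fin n → Fin n → Bool
  u v : Fin n

-- Finite sums and counting

Σᶠ-suc : (f : Fin (suc n) → ℕ) → Σᶠ f ≡ f zero + Σᶠ (f ∘ suc)
Σᶠ-suc f = cong (λ xs → f zero + sum xs) (trans (map-tabulate suc f) (sym (map-tabulate id (f ∘ suc))))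

Σᶠ-cong : {f g : Fin n → ℕ} → (∀ u → f u ≡ g u) → Σᶠ f ≡ Σᶠ g
Σᶠ-cong {zero}  f≗g = refl
Σᶠ-cong {suc n} {f} {g} f≗g = begin
  Σᶠ f                     ≡⟨ Σᶠ-suc f ⟩
  f zero + Σᶠ (f ∘ suc)    ≡⟨ cong₂ _+_ (f≗g zero) (Σᶠ-cong (f≗g ∘ suc)) ⟩
  g zero + Σᶠ (g ∘ suc)    ≡⟨ Σᶠ-suc g ⟨
  Σᶠ g                     ∎
  where open ≡-Reasoning

Σᶠ-distrib-+ : (f g : Fin n → ℕ) → Σᶠ (λ u → f u + g u) ≡ Σᶠ f + Σᶠ g
Σᶠ-distrib-+ {zero}  f g = refl
Σᶠ-distrib-+ {suc n} f g = begin
  Σᶠ (λ u → f u + g u)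
    ≡⟨ Σᶠ-suc (λ u → f u + g u) ⟩
  (f zero + g zero) + Σᶠ (λ u → f (suc u) + g (suc u))
    ≡⟨ cong ((f zero + g zero) +_) (Σᶠ-distrib-+ (f ∘ suc) (g ∘ suc)) ⟩
  (f zero + g zero) + (Σᶠ (f ∘ suc) + Σᶠ (g ∘ suc))
    ≡⟨ solve 4 (λ a b c d → (a :+ b) :+ (c :+ d) := (a :+ c) :+ (b :+ d)) refl
               (f zero) (g zero) (Σᶠ (f ∘ suc)) (Σᶠ (g ∘ suc)) ⟩
  (f zero + Σᶠ (f ∘ suc)) + (g zero + Σᶠ (g ∘ suc))
    ≡⟨ cong₂ _+_ (Σᶠ-suc f) (Σᶠ-suc g) ⟨
  Σᶠ f + Σᶠ g
    ∎
  where
    open ≡-Reasoning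
    open +-*-Solver

Σᶠ-mono-≤ : {f g : Fin n → ℕ} → (∀ u → f u ≤ g u) → Σᶠ f ≤ Σᶠ g
Σᶠ-mono-≤ {zero}  f≤g = z≤n
Σᶠ-mono-≤ {suc n} {f} {g} f≤g = begin
  Σᶠ f                   ≡⟨ Σᶠ-suc f ⟩
  f zero + Σᶠ (f ∘ suc)  ≤⟨ +-mono-≤ (f≤g zero) (Σᶠ-mono-≤ (f≤g ∘ suc)) ⟩
  g zero + Σᶠ (g ∘ suc)  ≡⟨ Σᶠ-suc g ⟨
  Σᶠ g                   ∎
  where open ≤-Reasoning

Σᶠ-zero : Σᶠ {n} (λ _ → 0) ≡ 0
Σᶠ-zero {zero}  = refl
Σᶠ-zero {suc n} = trans (Σᶠ-suc {n} (λ _ → 0)) (Σᶠ-zero {n})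

Σᶠ-comm : ∀ {m} (f : Fin n → Fin m → ℕ) → Σᶠ (λ u → Σᶠ (f u)) ≡ Σᶠ (λ v → Σᶠ (λ u → f u v))
Σᶠ-comm {zero} {m} f = sym (Σᶠ-zero {m})
Σᶠ-comm {suc n} {m} f = begin
  Σᶠ (λ u → Σᶠ (f u))
    ≡⟨ Σᶠ-suc (λ u → Σᶠ (f u)) ⟩
  Σᶠ (f zero) + Σᶠ (λ u → Σᶠ (f (suc u)))
    ≡⟨ cong (Σᶠ (f zero) +_) (Σᶠ-comm (f ∘ suc)) ⟩
  Σᶠ (f zero) + Σᶠ (λ v → Σᶠ (λ u → f (suc u) v))
    ≡⟨ Σᶠ-distrib-+ (f zero) (λ v → Σᶠ (λ u → f (suc u) v)) ⟨
  Σᶠ (λ v → f zero v + Σᶠ (λ u → f (suc u) v))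
    ≡⟨ Σᶠ-cong (λ v → Σᶠ-suc (λ u → f u v)) ⟨
  Σᶠ (λ v → Σᶠ (λ u → f u v))
    ∎
  where open ≡-Reasoning

Σᶠ≡0⇒≡0 : {f : Fin n → ℕ} → Σᶠ f ≡ 0 → ∀ u → f u ≡ 0
Σᶠ≡0⇒≡0 {suc n} {f} Σf≡0 zero    = m+n≡0⇒m≡0 (f zero) (trans (sym (Σᶠ-suc f)) Σf≡0)
Σᶠ≡0⇒≡0 {suc n} {f} Σf≡0 (suc u) = Σᶠ≡0⇒≡0 (m+n≡0⇒n≡0 (f zero) (trans (sym (Σᶠ-suc f)) Σf≡0)) u

Σᶠ≢0⇒∃≢0 : {f : Fin n → ℕ} → Σᶠ f ≢ 0 → ∃ λ u → f u ≢ 0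
Σᶠ≢0⇒∃≢0 {zero}      Σf≢0 = ⊥-elim (Σf≢0 refl)
Σᶠ≢0⇒∃≢0 {suc n} {f} Σf≢0 with f zero ℕ.≟ 0
... | no f₀≢0 = zero , f₀≢0
... | yes f₀≡0 with Σᶠ≢0⇒∃≢0 {f = f ∘ suc} (λ Σ≡0 → Σf≢0 (trans (Σᶠ-suc f) (cong₂ _+_ f₀≡0 Σ≡0)))
...   | u , fu≢0 = suc u , fu≢0

count : (Fin n → Fin n → Bool) → ℕ
count R = Σᶠ λ u → Σᶠ λ v → ind (R u v)

count-cong : (∀ u v → R u v ≡ R′ u v) → count R ≡ count R′
count-cong R≗R′ = Σᶠ-cong λ u → Σᶠ-cong λ v → cong ind (R≗R′ u v)

count-additive : (R R₁ R₂ : Fin n → Fin n → Bool) → (∀ u v → ind (R u v) ≡ ind (R₁ u v) + ind (R₂ u v)) →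
                 count R ≡ count R₁ + count R₂
count-additive R R₁ R₂ split =
  trans (Σᶠ-cong λ u → trans (Σᶠ-cong (split u)) (Σᶠ-distrib-+ (ind ∘ R₁ u) (ind ∘ R₂ u)))
        (Σᶠ-distrib-+ (λ u → Σᶠ (ind ∘ R₁ u)) (λ u → Σᶠ (ind ∘ R₂ u)))

count-subadditive : (R R₁ R₂ : Fin n → Fin n → Bool) → (∀ u v → ind (R u v) ≤ ind (R₁ u v) + ind (R₂ u v)) →
                    count R ≤ count R₁ + count R₂
count-subadditive R R₁ R₂ split =
  ≤-trans (Σᶠ-mono-≤ λ u → ≤-trans (Σᶠ-mono-≤ (split u)) (≤-reflexive (Σᶠ-distrib-+ (ind ∘ R₁ u) (ind ∘ R₂ u))))
          (≤-reflexive (Σᶠ-distrib-+ (λ u → Σᶠ (ind ∘ R₁ u)) (λ u → Σᶠ (ind ∘ R₂ u))))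

count-mono : (R R′ : Fin n → Fin n → Bool) → (∀ u v → T (R u v) → T (R′ u v)) → count R ≤ count R′
count-mono R R′ R⇒R′ = Σᶠ-mono-≤ λ u → Σᶠ-mono-≤ λ v → ind-mono (R⇒R′ u v)
  where
    ind-mono : ∀ {a b} → (T a → T b) → ind a ≤ ind b
    ind-mono {false}         _   = z≤n
    ind-mono {true}  {true}  _   = ≤-refl
    ind-mono {true}  {false} a⇒b = ⊥-elim (a⇒b tt)

count-transpose : (R : Fin n → Fin n → Bool) → count (flip R) ≡ count R
count-transpose R = Σᶠ-comm (λ u v → ind (R v u))

count≡0⇒≡false : (R : Fin n → Fin n → Bool) → count R ≡ 0 → ∀ u v → R u v ≡ false
count≡0⇒≡false R #R≡0 u v = ind≡0⇒≡false (Σᶠ≡0⇒≡0 (Σᶠ≡0⇒≡0 #R≡0 u) v)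
  where
    ind≡0⇒≡false : ∀ {b} → ind b ≡ 0 → b ≡ false
    ind≡0⇒≡false {false} _ = refl

count≢0⇒∃ : (R : Fin n → Fin n → Bool) → count R ≢ 0 → ∃₂ λ u v → T (R u v)
count≢0⇒∃ R #R≢0 with u , #Ru≢0 ← Σᶠ≢0⇒∃≢0 #R≢0 with v , Ruv≢0 ← Σᶠ≢0⇒∃≢0 #Ru≢0 =
  u , v , ind≢0⇒T Ruv≢0
  where
    ind≢0⇒T : ∀ {b} → ind b ≢ 0 → T b
    ind≢0⇒T {true}  _     = tt
    ind≢0⇒T {false} ind≢0 = ⊥-elim (ind≢0 refl)

count-symmetric : (R : Fin n → Fin n → Bool) → (∀ u v → R u v ≡ R v u) → (∀ u → R u u ≡ false) →
                  count R ≤ 2 * count (λ u v → (toℕ u <ᵇ toℕ v) ∧ R u v)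
count-symmetric R R-sym R-irrefl = begin
  count R                  ≤⟨ count-subadditive R L (flip L) split ⟩
  count L + count (flip L) ≡⟨ cong (count L +_) (count-transpose L) ⟩
  count L + count L        ≡⟨ cong (count L +_) (+-identityʳ (count L)) ⟨
  2 * count L              ∎
  where
    open ≤-Reasoning
    L : Fin _ → Fin _ → Bool
    L u v = (toℕ u <ᵇ toℕ v) ∧ R u v
    <ᵇ≡true : ∀ {x y} → x < y → (x <ᵇ y) ≡ true
    <ᵇ≡true x<y = Equivalence.to 𝔹.T-≡ (<⇒<ᵇ x<y)
    split : ∀ u v → ind (R u v) ≤ ind (L u v) + ind (L v u)
    split u v with <-cmp (toℕ u) (toℕ v)
    ... | tri< u<v _ _ rewrite <ᵇ≡true u<v = m≤m+n (ind (R u v)) _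
    ... | tri> _ _ v<u rewrite <ᵇ≡true v<u | R-sym v u = m≤n+m (ind (R u v)) _
    ... | tri≈ _ u≡v _ rewrite toℕ-injective u≡v | R-irrefl v = z≤n

-- Binary digits

odd : ℕ → Bool
odd 0             = false
odd 1             = true
odd (suc (suc x)) = odd x

⌊_/2^_⌋ : ℕ → ℕ → ℕ
⌊ x /2^ zero  ⌋ = x
⌊ x /2^ suc d ⌋ = ⌊ ⌊ x /2⌋ /2^ d ⌋

bit : ℕ → ℕ → Bool
bit d x = odd ⌊ x /2^ d ⌋

⌊/2⌋-odd-injective : ∀ x y → ⌊ x /2⌋ ≡ ⌊ y /2⌋ → odd x ≡ odd y → x ≡ y
⌊/2⌋-odd-injective 0             0             _  _  = refl
⌊/2⌋-odd-injective 1             1             _  _  = refl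
⌊/2⌋-odd-injective (suc (suc x)) (suc (suc y)) eq odd≡ =
  cong (λ w → suc (suc w)) (⌊/2⌋-odd-injective x y (suc-injective eq) odd≡)
⌊/2⌋-odd-injective 0             1             _  ()
⌊/2⌋-odd-injective 1             0             _  ()
⌊/2⌋-odd-injective 0             (suc (suc y)) () _
⌊/2⌋-odd-injective 1             (suc (suc y)) () _
⌊/2⌋-odd-injective (suc (suc x)) 0             () _
⌊/2⌋-odd-injective (suc (suc x)) 1             () _

⌊/2^suc⌋ : ∀ d x → ⌊ x /2^ suc d ⌋ ≡ ⌊ ⌊ x /2^ d ⌋ /2⌋
⌊/2^suc⌋ zero    x = refl
⌊/2^suc⌋ (suc d) x = ⌊/2^suc⌋ d ⌊ x /2⌋

⌊/2^⌋-injective : ∀ d x y → ⌊ x /2^ suc d ⌋ ≡ ⌊ y /2^ suc d ⌋ → bit d x ≡ bit d y →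
                  ⌊ x /2^ d ⌋ ≡ ⌊ y /2^ d ⌋
⌊/2^⌋-injective d x y high≡ =
  ⌊/2⌋-odd-injective _ _ (trans (sym (⌊/2^suc⌋ d x)) (trans high≡ (⌊/2^suc⌋ d y)))

⌊/2^⌋≡0 : ∀ d x → x < 2 ^ d → ⌊ x /2^ d ⌋ ≡ 0
⌊/2^⌋≡0 zero    zero    _          = refl
⌊/2^⌋≡0 zero    (suc x) (s≤s ())
⌊/2^⌋≡0 (suc d) x       x<2^1+d = ⌊/2^⌋≡0 d ⌊ x /2⌋ (⌊/2⌋< x x<2^1+d)
  where
    ⌊/2⌋< : ∀ {m} x → x < 2 * m → ⌊ x /2⌋ < m
    ⌊/2⌋< {zero}  x             ()
    ⌊/2⌋< {suc m} 0             _   = z<s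
    ⌊/2⌋< {suc m} 1             _   = z<s
    ⌊/2⌋< {suc m} (suc (suc x)) 2+x<2+2m =
      s<s (⌊/2⌋< x (s≤s⁻¹ (≤-trans (s≤s⁻¹ 2+x<2+2m) (≤-reflexive (+-suc m (m + 0))))))

bitsDiffer : ℕ → ℕ → ℕ → Bool
bitsDiffer zero    x y = false
bitsDiffer (suc d) x y = not ⌊ bit d x 𝔹.≟ bit d y ⌋ ∨ bitsDiffer d x y

bitsDiffer-refl : ∀ d x → bitsDiffer d x x ≡ false
bitsDiffer-refl zero    x = refl
bitsDiffer-refl (suc d) x with bit d x 𝔹.≟ bit d x
... | yes _   = bitsDiffer-refl d x
... | no  b≢b = ⊥-elim (b≢b refl)

bitsDiffer-≢ : ∀ d x y → ⌊ x /2^ d ⌋ ≡ ⌊ y /2^ d ⌋ → x ≢ y → bitsDiffer d x y ≡ true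
bitsDiffer-≢ zero    x y x≡y x≢y = ⊥-elim (x≢y x≡y)
bitsDiffer-≢ (suc d) x y high≡ x≢y with bit d x 𝔹.≟ bit d y
... | no  _     = refl
... | yes bits≡ = bitsDiffer-≢ d x y (⌊/2^⌋-injective d x y high≡ bits≡) x≢y

-- Vertex sets and the edges between them

_∩_ : VertexSet n → VertexSet n → VertexSet n
(A ∩ B) u = A u ∧ B u

_∪_ : VertexSet n → VertexSet n → VertexSet n
(A ∪ B) u = A u ∨ B u

∁ : VertexSet n → VertexSet n
∁ A u = not (A u)

Disjoint : VertexSet n → VertexSet n → Set
Disjoint A B = ∀ u → A u ∧ B u ≡ false

record IsDisjointUnion (U A B : VertexSet n) : Set where
  field
    cover    : ∀ u → U u ≡ A u ∨ B u
    disjoint : Disjoint A B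

open IsDisjointUnion

∪-isDisjointUnion : (A B : VertexSet n) → Disjoint A B → IsDisjointUnion (A ∪ B) A B
∪-isDisjointUnion A B A∩B=∅ = record { cover = λ _ → refl ; disjoint = A∩B=∅ }

isDisjointUnion-swap : IsDisjointUnion U A B → IsDisjointUnion U B A
isDisjointUnion-swap {A = A} {B = B} U=A⊎B = record
  { cover    = λ u → trans (cover U=A⊎B u) (𝔹.∨-comm (A u) (B u))
  ; disjoint = λ u → trans (𝔹.∧-comm (B u) (A u)) (disjoint U=A⊎B u)
  }

∁-isDisjointUnion : IsDisjointUnion U A B → IsDisjointUnion (∁ A) B (∁ U)
∁-isDisjointUnion {U = U} {A = A} {B = B} U=A⊎B = record { cover = cover′ ; disjoint = disjoint′ }
  where
    cover′ : ∀ u → not (A u) ≡ B u ∨ not (U u)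
    cover′ u rewrite cover U=A⊎B u with A u | B u | disjoint U=A⊎B u
    ... | true  | true  | ()
    ... | true  | false | _ = refl
    ... | false | true  | _ = refl
    ... | false | false | _ = refl
    disjoint′ : ∀ u → B u ∧ not (U u) ≡ false
    disjoint′ u rewrite cover U=A⊎B u with A u | B u
    ... | true  | b     = 𝔹.∧-zeroʳ b
    ... | false | true  = refl
    ... | false | false = refl

∩-∁-isDisjointUnion : (A P : VertexSet n) → IsDisjointUnion A (A ∩ P) (A ∩ ∁ P)
∩-∁-isDisjointUnion A P = record
  { cover    = λ u → begin
      A u                             ≡⟨ 𝔹.∧-identityʳ (A u) ⟨
      A u ∧ true                      ≡⟨ cong (A u ∧_) (𝔹.∨-inverseʳ (P u)) ⟨
      A u ∧ (P u ∨ not (P u))         ≡⟨ 𝔹.∧-distribˡ-∨ (A u) (P u) (not (P u)) ⟩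
      (A u ∧ P u) ∨ (A u ∧ not (P u)) ∎
  ; disjoint = λ u → ∧-∁-disjoint (A u) (P u)
  }
  where
    open ≡-Reasoning
    ∧-∁-disjoint : ∀ a p → (a ∧ p) ∧ (a ∧ not p) ≡ false
    ∧-∁-disjoint false _ = refl
    ∧-∁-disjoint true  p = 𝔹.∧-inverseʳ p

∁-disjoint : (A : VertexSet n) → Disjoint (∁ A) A
∁-disjoint A u = 𝔹.∧-inverseˡ (A u)

Disjoint-∩ˡ : (A B P : VertexSet n) → Disjoint A B → Disjoint (A ∩ P) B
Disjoint-∩ˡ A B P A∩B=∅ u = begin
  (A u ∧ P u) ∧ B u  ≡⟨ solve 3 (λ a p b → (a :* p) :* b := (a :* b) :* p) refl (A u) (P u) (B u) ⟩
  (A u ∧ B u) ∧ P u  ≡⟨ cong (_∧ P u) (A∩B=∅ u) ⟩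
  false              ∎
  where
    open ≡-Reasoning
    open ∨-∧-Solver

Disjoint-∩ʳ : (A B P : VertexSet n) → Disjoint A B → Disjoint A (B ∩ P)
Disjoint-∩ʳ A B P A∩B=∅ u = trans (sym (𝔹.∧-assoc (A u) (B u) (P u))) (cong (_∧ P u) (A∩B=∅ u))

arc : Graph n → VertexSet n → VertexSet n → Fin n → Fin n → Bool
arc G A B u v = adj G u v ∧ A u ∧ B v

-- For disjoint A and B this is e(A, B); cutQuery G A is numEdges G A (∁ A) by definition.
numEdges : Graph n → VertexSet n → VertexSet n → ℕ
numEdges G A B = count (arc G A B)

edgesBetween : Graph n → VertexSet n → VertexSet n → Fin n → Fin n → Bool
edgesBetween G A B u v = arc G A B u v ∨ arc G A B v u

arc-transpose : (G : Graph n) (A B : VertexSet n) → ∀ u v → arc G A B u v ≡ arc G B A v u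
arc-transpose G A B u v rewrite Graph.sym G u v = cong (adj G v u ∧_) (𝔹.∧-comm (A u) (B v))

numEdges-comm : (G : Graph n) (A B : VertexSet n) → numEdges G A B ≡ numEdges G B A
numEdges-comm G A B = trans (count-cong (arc-transpose G A B)) (count-transpose (arc G B A))

arc-splitˡ : (G : Graph n) (B : VertexSet n) → IsDisjointUnion U A₀ A₁ →
             ∀ u v → arc G U B u v ≡ arc G A₀ B u v ∨ arc G A₁ B u v
arc-splitˡ {A₀ = A₀} {A₁ = A₁} G B U=A₀⊎A₁ u v rewrite cover U=A₀⊎A₁ u =
  trans (cong (adj G u v ∧_) (𝔹.∧-distribʳ-∨ (B v) (A₀ u) (A₁ u))) (𝔹.∧-distribˡ-∨ (adj G u v) _ _)

arc-splitʳ : (G : Graph n) (A : VertexSet n) → IsDisjointUnion U B₀ B₁ →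
             ∀ u v → arc G A U u v ≡ arc G A B₀ u v ∨ arc G A B₁ u v
arc-splitʳ {B₀ = B₀} {B₁ = B₁} G A U=B₀⊎B₁ u v rewrite cover U=B₀⊎B₁ v =
  trans (cong (adj G u v ∧_) (𝔹.∧-distribˡ-∨ (A u) (B₀ v) (B₁ v))) (𝔹.∧-distribˡ-∨ (adj G u v) _ _)

numEdges-splitˡ : (G : Graph n) (B : VertexSet n) → IsDisjointUnion U A₀ A₁ →
                  numEdges G U B ≡ numEdges G A₀ B + numEdges G A₁ B
numEdges-splitˡ {U = U} {A₀ = A₀} {A₁ = A₁} G B U=A₀⊎A₁ =
  count-additive (arc G U B) (arc G A₀ B) (arc G A₁ B) λ u v →
    trans (cong ind (arc-splitˡ G B U=A₀⊎A₁ u v)) (ind-∨ (arc G A₀ B u v) (arc G A₁ B u v) (arcs-disjoint u v))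
  where
    ind-∨ : ∀ a b → a ∧ b ≡ false → ind (a ∨ b) ≡ ind a + ind b
    ind-∨ true  false _ = refl
    ind-∨ false _     _ = refl
    arcs-disjoint : ∀ u v → arc G A₀ B u v ∧ arc G A₁ B u v ≡ false
    arcs-disjoint u v = begin
      (a ∧ A₀ u ∧ B v) ∧ (a ∧ A₁ u ∧ B v) ≡⟨ solve 4 (λ a x y b → (a :* (x :* b)) :* (a :* (y :* b))
                                                           := (x :* y) :* (a :* (a :* (b :* b)))) refl
                                                 a (A₀ u) (A₁ u) (B v) ⟩
      (A₀ u ∧ A₁ u) ∧ (a ∧ a ∧ B v ∧ B v) ≡⟨ cong (_∧ (a ∧ a ∧ B v ∧ B v)) (disjoint U=A₀⊎A₁ u) ⟩
      false                               ∎
      where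
        open ≡-Reasoning
        open ∨-∧-Solver
        a = adj G u v

numEdges-splitʳ : (G : Graph n) (A : VertexSet n) → IsDisjointUnion U B₀ B₁ →
                  numEdges G A U ≡ numEdges G A B₀ + numEdges G A B₁
numEdges-splitʳ {U = U} {B₀ = B₀} {B₁ = B₁} G A U=B₀⊎B₁ = begin
  numEdges G A U                        ≡⟨ numEdges-comm G A U ⟩
  numEdges G U A                        ≡⟨ numEdges-splitˡ G A U=B₀⊎B₁ ⟩
  numEdges G B₀ A + numEdges G B₁ A     ≡⟨ cong₂ _+_ (numEdges-comm G B₀ A) (numEdges-comm G B₁ A) ⟩
  numEdges G A B₀ + numEdges G A B₁     ∎
  where open ≡-Reasoning

∨-interchange : ∀ p q r s → (p ∨ q) ∨ (r ∨ s) ≡ (p ∨ r) ∨ (q ∨ s)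
∨-interchange = solve 4 (λ p q r s → (p :+ q) :+ (r :+ s) := (p :+ r) :+ (q :+ s)) refl
  where open ∨-∧-Solver

edgesBetween-splitˡ : (G : Graph n) (B : VertexSet n) → IsDisjointUnion U A₀ A₁ →
                      ∀ u v → edgesBetween G U B u v ≡ edgesBetween G A₀ B u v ∨ edgesBetween G A₁ B u v
edgesBetween-splitˡ {A₀ = A₀} {A₁ = A₁} G B U=A₀⊎A₁ u v =
  trans (cong₂ _∨_ (arc-splitˡ G B U=A₀⊎A₁ u v) (arc-splitˡ G B U=A₀⊎A₁ v u))
        (∨-interchange (arc G A₀ B u v) (arc G A₁ B u v) (arc G A₀ B v u) (arc G A₁ B v u))

edgesBetween-splitʳ : (G : Graph n) (A : VertexSet n) → IsDisjointUnion U B₀ B₁ →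
                      ∀ u v → edgesBetween G A U u v ≡ edgesBetween G A B₀ u v ∨ edgesBetween G A B₁ u v
edgesBetween-splitʳ {B₀ = B₀} {B₁ = B₁} G A U=B₀⊎B₁ u v =
  trans (cong₂ _∨_ (arc-splitʳ G A U=B₀⊎B₁ u v) (arc-splitʳ G A U=B₀⊎B₁ v u))
        (∨-interchange (arc G A B₀ u v) (arc G A B₁ u v) (arc G A B₀ v u) (arc G A B₁ v u))

edgesBetween-empty : (G : Graph n) (A B : VertexSet n) → numEdges G A B ≡ 0 →
                     ∀ u v → edgesBetween G A B u v ≡ false
edgesBetween-empty G A B #E≡0 u v
  rewrite count≡0⇒≡false (arc G A B) #E≡0 u v | count≡0⇒≡false (arc G A B) #E≡0 v u = refl

edgesBetween-∁ : (G : Graph n) (B : VertexSet n) →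
                 ∀ u v → edgesBetween G (∁ B) B u v ≡ adj G u v ∧ not ⌊ B u 𝔹.≟ B v ⌋
edgesBetween-∁ G B u v rewrite Graph.sym G v u = one-side-each (adj G u v) (B u) (B v)
  where
    one-side-each : ∀ a x y → (a ∧ not x ∧ y) ∨ (a ∧ not y ∧ x) ≡ a ∧ not ⌊ x 𝔹.≟ y ⌋
    one-side-each false _     _     = refl
    one-side-each true  false false = refl
    one-side-each true  false true  = refl
    one-side-each true  true  false = refl
    one-side-each true  true  true  = refl

cut-identity : (G : Graph n) (A B : VertexSet n) → Disjoint A B →
               cutQuery G A + cutQuery G B ≡ cutQuery G (A ∪ B) + 2 * numEdges G A B
cut-identity G A B A∩B=∅ = begin
  cutQuery G A + cutQuery G B
    ≡⟨⟩
  e A (∁ A) + e B (∁ B)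
    ≡⟨ cong₂ _+_ (numEdges-splitʳ G A (∁-isDisjointUnion A∪B))
                 (numEdges-splitʳ G B (∁-isDisjointUnion (isDisjointUnion-swap A∪B))) ⟩
  (e A B + e A Rest) + (e B A + e B Rest)
    ≡⟨ cong (λ x → (e A B + e A Rest) + (x + e B Rest)) (numEdges-comm G B A) ⟩
  (e A B + e A Rest) + (e A B + e B Rest)
    ≡⟨ solve 3 (λ x y z → (x :+ y) :+ (x :+ z) := (y :+ z) :+ con 2 :* x) refl (e A B) (e A Rest) (e B Rest) ⟩
  (e A Rest + e B Rest) + 2 * e A B
    ≡⟨ cong (_+ 2 * e A B) (numEdges-splitˡ G Rest A∪B) ⟨
  cutQuery G (A ∪ B) + 2 * e A B
    ∎
  where
    open ≡-Reasoning
    open +-*-Solver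
    e = numEdges G
    Rest = ∁ (A ∪ B)
    A∪B = ∪-isDisjointUnion A B A∩B=∅

balanced⇒numEdges≡0 : (G : Graph n) (A B : VertexSet n) → Disjoint A B →
                      cutQuery G A + cutQuery G B ≡ cutQuery G (A ∪ B) → numEdges G A B ≡ 0
balanced⇒numEdges≡0 G A B A∩B=∅ balanced =
  *-cancelˡ-≡ (numEdges G A B) 0 2 (+-cancelˡ-≡ (cutQuery G (A ∪ B)) (2 * numEdges G A B) 0
    (trans (sym (cut-identity G A B A∩B=∅)) (trans balanced (sym (+-identityʳ (cutQuery G (A ∪ B)))))))

numEdges≡0⇒balanced : (G : Graph n) (A B : VertexSet n) → Disjoint A B →
                      numEdges G A B ≡ 0 → cutQuery G A + cutQuery G B ≡ cutQuery G (A ∪ B)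
numEdges≡0⇒balanced G A B A∩B=∅ #E≡0 =
  trans (cut-identity G A B A∩B=∅) (trans (cong (λ e → cutQuery G (A ∪ B) + 2 * e) #E≡0) (+-identityʳ _))

-- Query trees

noEdges : Fin n → Fin n → Bool
noEdges _ _ = false

addEdges : (Fin n → Fin n → Bool) → QueryTree n → QueryTree n
addEdges F (done E)  = done (λ u v → F u v ∨ E u v)
addEdges F (ask A k) = ask A (addEdges F ∘ k)

union : QueryTree n → QueryTree n → QueryTree n
union (done E)  t = addEdges E t
union (ask A k) t = ask A (λ a → union (k a) t)

output-addEdges : (G : Graph n) (F : Fin n → Fin n → Bool) (t : QueryTree n) →
                  ∀ u v → output G (addEdges F t) u v ≡ F u v ∨ output G t u v
output-addEdges G F (done E)  u v = refl
output-addEdges G F (ask A k) u v = output-addEdges G F (k (cutQuery G A)) u v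

numQueries-addEdges : (G : Graph n) (F : Fin n → Fin n → Bool) (t : QueryTree n) →
                      numQueries G (addEdges F t) ≡ numQueries G t
numQueries-addEdges G F (done E)  = refl
numQueries-addEdges G F (ask A k) = cong suc (numQueries-addEdges G F (k (cutQuery G A)))

output-union : (G : Graph n) (t₁ t₂ : QueryTree n) →
               ∀ u v → output G (union t₁ t₂) u v ≡ output G t₁ u v ∨ output G t₂ u v
output-union G (done E)  t₂ u v = output-addEdges G E t₂ u v
output-union G (ask A k) t₂ u v = output-union G (k (cutQuery G A)) t₂ u v

numQueries-union : (G : Graph n) (t₁ t₂ : QueryTree n) →
                   numQueries G (union t₁ t₂) ≡ numQueries G t₁ + numQueries G t₂
numQueries-union G (done E)  t₂ = numQueries-addEdges G E t₂
numQueries-union G (ask A k) t₂ = cong suc (numQueries-union G (k (cutQuery G A)) t₂)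

ifEdges : VertexSet n → VertexSet n → QueryTree n → QueryTree n
ifEdges A B t = ask A λ a → ask B λ b → ask (A ∪ B) λ c → unless (a + b ℕ.≟ c)
  where
    unless : {P : Set} → Dec P → QueryTree _
    unless (yes _) = done noEdges
    unless (no  _) = t

ifEdges-output : (G : Graph n) (A B : VertexSet n) (t : QueryTree n) → Disjoint A B →
                 (numEdges G A B ≢ 0 → ∀ u v → output G t u v ≡ edgesBetween G A B u v) →
                 ∀ u v → output G (ifEdges A B t) u v ≡ edgesBetween G A B u v
ifEdges-output G A B t A∩B=∅ learns u v with cutQuery G A + cutQuery G B ℕ.≟ cutQuery G (A ∪ B)
... | yes balanced   = sym (edgesBetween-empty G A B (balanced⇒numEdges≡0 G A B A∩B=∅ balanced) u v)
... | no  unbalanced = learns (unbalanced ∘ numEdges≡0⇒balanced G A B A∩B=∅) u v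

ifEdges-numQueries : (G : Graph n) (A B : VertexSet n) (t : QueryTree n) {k : ℕ} → Disjoint A B →
                     (numEdges G A B ≢ 0 → numQueries G t ≤ k) → numQueries G (ifEdges A B t) ≤ 3 + k
ifEdges-numQueries G A B t A∩B=∅ cost with cutQuery G A + cutQuery G B ℕ.≟ cutQuery G (A ∪ B)
... | yes _          = s≤s (s≤s (s≤s z≤n))
... | no  unbalanced = s≤s (s≤s (s≤s (cost (unbalanced ∘ numEdges≡0⇒balanced G A B A∩B=∅))))

-- Learning the edges between two vertex sets

bitAt : ℕ → VertexSet n
bitAt d u = bit d (toℕ u)

biclique : VertexSet n → VertexSet n → Fin n → Fin n → Bool
biclique A B u v = (A u ∧ B v) ∨ (A v ∧ B u)

-- Meant for A and B lying in blocks of 2 ^ d₁ and 2 ^ d₂ consecutive indices (WithinBlock), so that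
-- halving them d₁ and d₂ times leaves single vertices.
learnBetween : ℕ → ℕ → VertexSet n → VertexSet n → QueryTree n
learnBetween zero     zero     A B = ifEdges A B (done (biclique A B))
learnBetween zero     (suc d₂) A B =
  ifEdges A B (union (learnBetween zero d₂ A (B ∩ bitAt d₂)) (learnBetween zero d₂ A (B ∩ ∁ (bitAt d₂))))
learnBetween (suc d₁) d₂       A B =
  ifEdges A B (union (learnBetween d₁ d₂ (A ∩ bitAt d₁) B) (learnBetween d₁ d₂ (A ∩ ∁ (bitAt d₁)) B))

WithinBlock : ℕ → VertexSet n → Set
WithinBlock d A = ∀ {u v} → T (A u) → T (A v) → ⌊ toℕ u /2^ d ⌋ ≡ ⌊ toℕ v /2^ d ⌋

WithinBlock-all : ∀ d → n ≤ 2 ^ d → (A : VertexSet n) → WithinBlock d A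
WithinBlock-all d n≤2^d A {u} {v} _ _ =
  trans (⌊/2^⌋≡0 d (toℕ u) (<-≤-trans (toℕ<n u) n≤2^d)) (sym (⌊/2^⌋≡0 d (toℕ v) (<-≤-trans (toℕ<n v) n≤2^d)))

WithinBlock-zero⇒≡ : (A : VertexSet n) → WithinBlock 0 A → T (A u) → T (A v) → u ≡ v
WithinBlock-zero⇒≡ A A-block u∈A v∈A = toℕ-injective (A-block u∈A v∈A)

WithinBlock-∩ : ∀ d (A P : VertexSet n) → (∀ {u v} → T (P u) → T (P v) → bitAt d u ≡ bitAt d v) →
                WithinBlock (suc d) A → WithinBlock d (A ∩ P)
WithinBlock-∩ d A P P⇒bit≡ A-block {u} {v} u∈A∩P v∈A∩P =
  ⌊/2^⌋-injective d (toℕ u) (toℕ v) (A-block (proj₁ u∈A×P) (proj₁ v∈A×P)) (P⇒bit≡ (proj₂ u∈A×P) (proj₂ v∈A×P))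
  where
    u∈A×P = Equivalence.to 𝔹.T-∧ u∈A∩P
    v∈A×P = Equivalence.to 𝔹.T-∧ v∈A∩P

WithinBlock-∩-bitAt : ∀ d (A : VertexSet n) → WithinBlock (suc d) A → WithinBlock d (A ∩ bitAt d)
WithinBlock-∩-bitAt d A = WithinBlock-∩ d A (bitAt d) λ u∈P v∈P →
  trans (Equivalence.to 𝔹.T-≡ u∈P) (sym (Equivalence.to 𝔹.T-≡ v∈P))

WithinBlock-∩-∁bitAt : ∀ d (A : VertexSet n) → WithinBlock (suc d) A → WithinBlock d (A ∩ ∁ (bitAt d))
WithinBlock-∩-∁bitAt d A = WithinBlock-∩ d A (∁ (bitAt d)) λ u∈P v∈P →
  trans (Equivalence.to 𝔹.T-not-≡ u∈P) (sym (Equivalence.to 𝔹.T-not-≡ v∈P))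

arc-saturated : (G : Graph n) (A B : VertexSet n) → (∀ {u v} → T (A u ∧ B v) → T (adj G u v)) →
                ∀ u v → arc G A B u v ≡ A u ∧ B v
arc-saturated G A B AB⇒adj u v with A u ∧ B v in uv∈A×B
... | false = 𝔹.∧-zeroʳ (adj G u v)
... | true  = trans (𝔹.∧-identityʳ (adj G u v)) (Equivalence.to 𝔹.T-≡ (AB⇒adj (Equivalence.from 𝔹.T-≡ uv∈A×B)))

edgesBetween-biclique : (G : Graph n) (A B : VertexSet n) → WithinBlock 0 A → WithinBlock 0 B →
                        numEdges G A B ≢ 0 → ∀ u v → edgesBetween G A B u v ≡ biclique A B u v
edgesBetween-biclique G A B A-point B-point #E≢0 u v with u₀ , v₀ , u₀v₀∈E ← count≢0⇒∃ (arc G A B) #E≢0 =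
  cong₂ _∨_ (arc-saturated G A B saturated u v) (arc-saturated G A B saturated v u)
  where
    u₀v₀∈adj×A×B = Equivalence.to (𝔹.T-∧ {adj G u₀ v₀}) u₀v₀∈E
    u₀∈A×v₀∈B = Equivalence.to (𝔹.T-∧ {A u₀} {B v₀}) (proj₂ u₀v₀∈adj×A×B)
    saturated : ∀ {u v} → T (A u ∧ B v) → T (adj G u v)
    saturated {u} {v} uv∈A×B =
      subst₂ (λ x y → T (adj G x y)) (WithinBlock-zero⇒≡ A A-point (proj₁ u₀∈A×v₀∈B) (proj₁ u∈A×v∈B))
                                     (WithinBlock-zero⇒≡ B B-point (proj₂ u₀∈A×v₀∈B) (proj₂ u∈A×v∈B))
                                     (proj₁ u₀v₀∈adj×A×B)
      where u∈A×v∈B = Equivalence.to (𝔹.T-∧ {A u} {B v}) uv∈A×B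

learnBetween-output : (G : Graph n) → ∀ d₁ d₂ (A B : VertexSet n) →
                      Disjoint A B → WithinBlock d₁ A → WithinBlock d₂ B →
                      ∀ u v → output G (learnBetween d₁ d₂ A B) u v ≡ edgesBetween G A B u v
learnBetween-output G zero zero A B A∩B=∅ A-point B-point =
  ifEdges-output G A B _ A∩B=∅ λ #E≢0 u v → sym (edgesBetween-biclique G A B A-point B-point #E≢0 u v)
learnBetween-output G zero (suc d₂) A B A∩B=∅ A-point B-block = ifEdges-output G A B _ A∩B=∅ λ _ u v → begin
  output G (union tᵒ tᵉ) u v                          ≡⟨ output-union G tᵒ tᵉ u v ⟩
  output G tᵒ u v ∨ output G tᵉ u v                   ≡⟨ cong₂ _∨_ (learnsᵒ u v) (learnsᵉ u v) ⟩
  edgesBetween G A Bᵒ u v ∨ edgesBetween G A Bᵉ u v   ≡⟨ edgesBetween-splitʳ G A B-halves u v ⟨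
  edgesBetween G A B u v                              ∎
  where
    open ≡-Reasoning
    Bᵒ = B ∩ bitAt d₂
    Bᵉ = B ∩ ∁ (bitAt d₂)
    tᵒ = learnBetween zero d₂ A Bᵒ
    tᵉ = learnBetween zero d₂ A Bᵉ
    B-halves = ∩-∁-isDisjointUnion B (bitAt d₂)
    learnsᵒ = learnBetween-output G zero d₂ A Bᵒ (Disjoint-∩ʳ A B (bitAt d₂) A∩B=∅) A-point
                                  (WithinBlock-∩-bitAt d₂ B B-block)
    learnsᵉ = learnBetween-output G zero d₂ A Bᵉ (Disjoint-∩ʳ A B (∁ (bitAt d₂)) A∩B=∅) A-point
                                  (WithinBlock-∩-∁bitAt d₂ B B-block)
learnBetween-output G (suc d₁) d₂ A B A∩B=∅ A-block B-block = ifEdges-output G A B _ A∩B=∅ λ _ u v → begin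
  output G (union tᵒ tᵉ) u v                          ≡⟨ output-union G tᵒ tᵉ u v ⟩
  output G tᵒ u v ∨ output G tᵉ u v                   ≡⟨ cong₂ _∨_ (learnsᵒ u v) (learnsᵉ u v) ⟩
  edgesBetween G Aᵒ B u v ∨ edgesBetween G Aᵉ B u v   ≡⟨ edgesBetween-splitˡ G B A-halves u v ⟨
  edgesBetween G A B u v                              ∎
  where
    open ≡-Reasoning
    Aᵒ = A ∩ bitAt d₁
    Aᵉ = A ∩ ∁ (bitAt d₁)
    tᵒ = learnBetween d₁ d₂ Aᵒ B
    tᵉ = learnBetween d₁ d₂ Aᵉ B
    A-halves = ∩-∁-isDisjointUnion A (bitAt d₁)
    learnsᵒ = learnBetween-output G d₁ d₂ Aᵒ B (Disjoint-∩ˡ A B (bitAt d₁) A∩B=∅)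
                                  (WithinBlock-∩-bitAt d₁ A A-block) B-block
    learnsᵉ = learnBetween-output G d₁ d₂ Aᵉ B (Disjoint-∩ˡ A B (∁ (bitAt d₁)) A∩B=∅)
                                  (WithinBlock-∩-∁bitAt d₁ A A-block) B-block

-- A pair of halves joined by an edge has e₀ + e₁ ≥ 1, which pays for the six queries of the two probes.
halving-cost : ∀ {q₀ q₁} e₀ e₁ h → q₀ ≤ 3 + 6 * e₀ * h → q₁ ≤ 3 + 6 * e₁ * h → e₀ + e₁ ≢ 0 →
               q₀ + q₁ ≤ 6 * (e₀ + e₁) * suc h
halving-cost {q₀} {q₁} e₀ e₁ h q₀≤ q₁≤ e≢0 = begin
  q₀ + q₁                             ≤⟨ +-mono-≤ q₀≤ q₁≤ ⟩
  (3 + 6 * e₀ * h) + (3 + 6 * e₁ * h) ≡⟨ solve 3 (λ x y h → (con 3 :+ con 6 :* x :* h) :+ (con 3 :+ con 6 :* y :* h)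
                                                         := con 6 :+ con 6 :* (x :+ y) :* h) refl e₀ e₁ h ⟩
  6 + 6 * (e₀ + e₁) * h               ≤⟨ +-monoˡ-≤ (6 * (e₀ + e₁) * h) (*-monoʳ-≤ 6 (n≢0⇒n>0 e≢0)) ⟩
  6 * (e₀ + e₁) + 6 * (e₀ + e₁) * h   ≡⟨ *-suc (6 * (e₀ + e₁)) h ⟨
  6 * (e₀ + e₁) * suc h               ∎
  where
    open ≤-Reasoning
    open +-*-Solver

learnBetween-numQueries : (G : Graph n) → ∀ d₁ d₂ (A B : VertexSet n) → Disjoint A B →
                          numQueries G (learnBetween d₁ d₂ A B) ≤ 3 + 6 * numEdges G A B * (d₁ + d₂)
learnBetween-numQueries G zero zero A B A∩B=∅ = ifEdges-numQueries G A B _ A∩B=∅ λ _ → z≤n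
learnBetween-numQueries G zero (suc d₂) A B A∩B=∅ = ifEdges-numQueries G A B _ A∩B=∅ λ #E≢0 → begin
  numQueries G (union tᵒ tᵉ)
    ≡⟨ numQueries-union G tᵒ tᵉ ⟩
  numQueries G tᵒ + numQueries G tᵉ
    ≤⟨ halving-cost (numEdges G A Bᵒ) (numEdges G A Bᵉ) d₂ costᵒ costᵉ (#E≢0 ∘ trans #E-split) ⟩
  6 * (numEdges G A Bᵒ + numEdges G A Bᵉ) * suc d₂
    ≡⟨ cong (λ e → 6 * e * suc d₂) #E-split ⟨
  6 * numEdges G A B * suc d₂
    ∎
  where
    open ≤-Reasoning
    Bᵒ = B ∩ bitAt d₂
    Bᵉ = B ∩ ∁ (bitAt d₂)
    tᵒ = learnBetween zero d₂ A Bᵒ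
    tᵉ = learnBetween zero d₂ A Bᵉ
    costᵒ = learnBetween-numQueries G zero d₂ A Bᵒ (Disjoint-∩ʳ A B (bitAt d₂) A∩B=∅)
    costᵉ = learnBetween-numQueries G zero d₂ A Bᵉ (Disjoint-∩ʳ A B (∁ (bitAt d₂)) A∩B=∅)
    #E-split = numEdges-splitʳ G A (∩-∁-isDisjointUnion B (bitAt d₂))
learnBetween-numQueries G (suc d₁) d₂ A B A∩B=∅ = ifEdges-numQueries G A B _ A∩B=∅ λ #E≢0 → begin
  numQueries G (union tᵒ tᵉ)
    ≡⟨ numQueries-union G tᵒ tᵉ ⟩
  numQueries G tᵒ + numQueries G tᵉ
    ≤⟨ halving-cost (numEdges G Aᵒ B) (numEdges G Aᵉ B) (d₁ + d₂) costᵒ costᵉ (#E≢0 ∘ trans #E-split) ⟩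
  6 * (numEdges G Aᵒ B + numEdges G Aᵉ B) * suc (d₁ + d₂)
    ≡⟨ cong (λ e → 6 * e * suc (d₁ + d₂)) #E-split ⟨
  6 * numEdges G A B * suc (d₁ + d₂)
    ∎
  where
    open ≤-Reasoning
    Aᵒ = A ∩ bitAt d₁
    Aᵉ = A ∩ ∁ (bitAt d₁)
    tᵒ = learnBetween d₁ d₂ Aᵒ B
    tᵉ = learnBetween d₁ d₂ Aᵉ B
    costᵒ = learnBetween-numQueries G d₁ d₂ Aᵒ B (Disjoint-∩ˡ A B (bitAt d₁) A∩B=∅)
    costᵉ = learnBetween-numQueries G d₁ d₂ Aᵉ B (Disjoint-∩ˡ A B (∁ (bitAt d₁)) A∩B=∅)
    #E-split = numEdges-splitˡ G B (∩-∁-isDisjointUnion A (bitAt d₁))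

-- Cross edges of a partition

partBit : (Fin n → Fin z) → ℕ → VertexSet n
partBit part j u = bit j (toℕ (part u))

learnCrossEdges : (Fin n → Fin z) → ℕ → ℕ → QueryTree n
learnCrossEdges part D zero    = done noEdges
learnCrossEdges part D (suc j) =
  union (learnBetween D D (∁ (partBit part j)) (partBit part j)) (learnCrossEdges part D j)

learnCrossEdges-output : (G : Graph n) (part : Fin n → Fin z) → ∀ D → n ≤ 2 ^ D → ∀ j u v →
                         output G (learnCrossEdges part D j) u v
                           ≡ adj G u v ∧ bitsDiffer j (toℕ (part u)) (toℕ (part v))
learnCrossEdges-output G part D n≤2^D zero    u v = sym (𝔹.∧-zeroʳ (adj G u v))
learnCrossEdges-output G part D n≤2^D (suc j) u v = begin
  output G (union tⱼ (learnCrossEdges part D j)) u v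
    ≡⟨ output-union G tⱼ (learnCrossEdges part D j) u v ⟩
  output G tⱼ u v ∨ output G (learnCrossEdges part D j) u v
    ≡⟨ cong₂ _∨_ learnsⱼ (learnCrossEdges-output G part D n≤2^D j u v) ⟩
  edgesBetween G (∁ Bⱼ) Bⱼ u v ∨ (adj G u v ∧ bitsDiffer j x y)
    ≡⟨ cong (_∨ (adj G u v ∧ bitsDiffer j x y)) (edgesBetween-∁ G Bⱼ u v) ⟩
  (adj G u v ∧ not ⌊ Bⱼ u 𝔹.≟ Bⱼ v ⌋) ∨ (adj G u v ∧ bitsDiffer j x y)
    ≡⟨ 𝔹.∧-distribˡ-∨ (adj G u v) (not ⌊ Bⱼ u 𝔹.≟ Bⱼ v ⌋) (bitsDiffer j x y) ⟨
  adj G u v ∧ bitsDiffer (suc j) x y ∎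
  where
    open ≡-Reasoning
    Bⱼ = partBit part j
    tⱼ = learnBetween D D (∁ Bⱼ) Bⱼ
    x = toℕ (part u)
    y = toℕ (part v)
    learnsⱼ = learnBetween-output G D D (∁ Bⱼ) Bⱼ (∁-disjoint Bⱼ)
                                  (WithinBlock-all D n≤2^D (∁ Bⱼ)) (WithinBlock-all D n≤2^D Bⱼ) u v

bitsDiffer-crossAdj : (G : Graph n) (part : Fin n → Fin z) → ∀ D → z ≤ 2 ^ D →
                      ∀ u v → adj G u v ∧ bitsDiffer D (toℕ (part u)) (toℕ (part v)) ≡ crossAdj G part u v
bitsDiffer-crossAdj G part D z≤2^D u v with part u F.≟ part v
... | yes pu≡pv rewrite pu≡pv = cong (adj G u v ∧_) (bitsDiffer-refl D (toℕ (part v)))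
... | no  pu≢pv =
  cong (adj G u v ∧_) (bitsDiffer-≢ D _ _ (trans (label-high u) (sym (label-high v))) (pu≢pv ∘ toℕ-injective))
  where
    label-high : ∀ w → ⌊ toℕ (part w) /2^ D ⌋ ≡ 0
    label-high w = ⌊/2^⌋≡0 D _ (<-≤-trans (toℕ<n (part w)) z≤2^D)

crossAdj-sym : (G : Graph n) (part : Fin n → Fin z) → ∀ u v → crossAdj G part u v ≡ crossAdj G part v u
crossAdj-sym G part u v rewrite Graph.sym G u v with part u F.≟ part v | part v F.≟ part u
... | yes _      | yes _      = refl
... | no  _      | no  _      = refl
... | yes pu≡pv  | no  pv≢pu = ⊥-elim (pv≢pu (sym pu≡pv))
... | no  pu≢pv  | yes pv≡pu = ⊥-elim (pu≢pv (sym pv≡pu))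

numEdges-partBit≤ : (G : Graph n) (part : Fin n → Fin z) →
                    ∀ j → numEdges G (∁ (partBit part j)) (partBit part j) ≤ 2 * crossCount G part
numEdges-partBit≤ G part j = begin
  numEdges G (∁ Bⱼ) Bⱼ     ≤⟨ count-mono (arc G (∁ Bⱼ) Bⱼ) (crossAdj G part) arc⇒cross ⟩
  count (crossAdj G part)  ≤⟨ count-symmetric (crossAdj G part) (crossAdj-sym G part) crossAdj-irrefl ⟩
  2 * crossCount G part    ∎
  where
    open ≤-Reasoning
    Bⱼ = partBit part j
    crossAdj-irrefl : ∀ u → crossAdj G part u u ≡ false
    crossAdj-irrefl u rewrite irrefl G u = refl
    arc⇒cross : ∀ u v → T (arc G (∁ Bⱼ) Bⱼ u v) → T (crossAdj G part u v)
    arc⇒cross u v uv∈E with part u F.≟ part v | Equivalence.to 𝔹.T-∧ uv∈E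
    ... | no  _     | uv∈adj , _     = Equivalence.from 𝔹.T-∧ (uv∈adj , tt)
    ... | yes pu≡pv | _      , sides =
      ⊥-elim (subst T (𝔹.∧-inverseˡ (Bⱼ v)) (subst (λ p → T (not (bit j (toℕ p)) ∧ Bⱼ v)) pu≡pv sides))

learnCrossEdges-numQueries : (G : Graph n) (part : Fin n → Fin z) → ∀ D j →
                             numQueries G (learnCrossEdges part D j)
                               ≤ j * (3 + 6 * (2 * crossCount G part) * (D + D))
learnCrossEdges-numQueries G part D zero    = z≤n
learnCrossEdges-numQueries G part D (suc j) = begin
  numQueries G (union tⱼ (learnCrossEdges part D j))
    ≡⟨ numQueries-union G tⱼ (learnCrossEdges part D j) ⟩
  numQueries G tⱼ + numQueries G (learnCrossEdges part D j)
    ≤⟨ +-mono-≤ costⱼ (learnCrossEdges-numQueries G part D j) ⟩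
  suc j * (3 + 6 * (2 * crossCount G part) * (D + D))
    ∎
  where
    open ≤-Reasoning
    Bⱼ = partBit part j
    tⱼ = learnBetween D D (∁ Bⱼ) Bⱼ
    costⱼ : numQueries G tⱼ ≤ 3 + 6 * (2 * crossCount G part) * (D + D)
    costⱼ = ≤-trans (learnBetween-numQueries G D D (∁ Bⱼ) Bⱼ (∁-disjoint Bⱼ))
                    (+-monoʳ-≤ 3 (*-monoˡ-≤ (D + D) (*-monoʳ-≤ 6 (numEdges-partBit≤ G part j))))

surjective⇒≤ : {f : Fin n → Fin z} → Surjective _≡_ _≡_ f → z ≤ n
surjective⇒≤ {f = f} surj = injective⇒≤ {f = section} λ {y} {y′} eq →
  trans (sym (proj₂ (surj y) refl)) (trans (cong f eq) (proj₂ (surj y′) refl))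
  where
    section = λ y → proj₁ (surj y)

n<2^logFactor : ∀ n → n < 2 ^ logFactor n
n<2^logFactor n = ≰⇒> λ 2^L≤n →
  1+n≰n (subst (_≤ ⌊log₂ n ⌋) (⌊log₂[2^n]⌋≡n (logFactor n)) (⌊log₂⌋-mono-≤ 2^L≤n))

cost-bound : ∀ z m D .{{_ : NonZero z}} .{{_ : NonZero D}} →
             D * (3 + 6 * (2 * m) * (D + D)) ≤ 27 * (z + m) * D ^ 2
cost-bound z m D = begin
  D * (3 + 6 * (2 * m) * (D + D))
    ≡⟨ solve 2 (λ m D → D :* (con 3 :+ con 6 :* (con 2 :* m) :* (D :+ D))
                      := con 3 :* D :+ con 24 :* (m :* (D :* D))) refl m D ⟩
  3 * D + 24 * (m * (D * D))
    ≤⟨ +-mono-≤ (*-monoʳ-≤ 3 D≤zD²) (*-monoˡ-≤ (m * (D * D)) (m≤m+n 24 3)) ⟩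
  3 * (z * (D * D)) + 27 * (m * (D * D))
    ≤⟨ +-monoˡ-≤ (27 * (m * (D * D))) (*-monoˡ-≤ (z * (D * D)) (m≤m+n 3 24)) ⟩
  27 * (z * (D * D)) + 27 * (m * (D * D))
    ≡⟨ solve 3 (λ z m D → con 27 :* (z :* (D :* D)) :+ con 27 :* (m :* (D :* D))
                        := con 27 :* (z :+ m) :* (D :^ 2)) refl z m D ⟩
  27 * (z + m) * D ^ 2
    ∎
  where
    open ≤-Reasoning
    open +-*-Solver
    D≤zD² : D ≤ z * (D * D)
    D≤zD² = ≤-trans (m≤m*n D D) (m≤n*m (D * D) z)

mainTheorem7 : ∃[ c ] ∃[ k ] ((n z : ℕ) → (part : Fin n → Fin z)
    → Surjective _≡_ _≡_ part
    → Σ (QueryTree n) λ T → (G : Graph n)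
      → ((u v : Fin n) → output G T u v ≡ crossAdj G part u v)
        × (numQueries G T ≤ c * (z + crossCount G part) * logFactor n ^ k))
mainTheorem7 = 27 , 2 , λ where
  n zero    part _    → done noEdges , λ G → (λ u → ⊥-elim (¬Fin0 (part u))) , z≤n
  n (suc z) part surj →
    let D     = logFactor n
        n≤2^D = <⇒≤ (n<2^logFactor n)
        z≤2^D = ≤-trans (surjective⇒≤ surj) n≤2^D
    in learnCrossEdges part D D , λ G →
         (λ u v → trans (learnCrossEdges-output G part D n≤2^D D u v) (bitsDiffer-crossAdj G part D z≤2^D u v))
       , ≤-trans (learnCrossEdges-numQueries G part D D) (cost-bound (suc z) (crossCount G part) D)
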